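{- Let $t\ge3$, let $\sigma:x\mapsto x^{q^\nu}$ with $\gcd(\nu,t)=1$, and let $\mathbb{L}=\{\langle(\mu,\mu^\sigma)\rangle_{q^t}:\mu\in\mathbb{F}_{q^t}^*\}\subseteq\mathrm{PG}(1,q^t)$. Then $\{\mathcal{F}(X): X\in\mathbb{L}\}=\mathcal{S}_0$, where $\mathcal{S}_0=\{S_{0,k}: k\in\mathbb{F}_{q^t},\,N(k)=1\}$ and $S_{0,k}=\{\langle(z,kz)\rangle_q: z\in\mathbb{F}_{q^t}^*\}$.
   Context: $N(x)=x^{(q^t-1)/(q-1)}$ is the norm of $x\in\mathbb{F}_{q^t}$ over $\mathbb{F}_q$. $\mathrm{PG}(2t-1,q)$ is identified with $\mathrm{PG}_q(\mathbb{F}_{q^t}^2)$, whose points are $\langle v\rangle_q$, $v\in\mathbb{F}_{q^t}^2\setminus\{0\}$. The field reduction $\mathcal{F}$ maps a point $X=\langle(a,b)\rangle_{q^t}$ of $\mathrm{PG}(1,q^t)$ to the $(t-1)$-subspace $\mathcal{F}(X)=\{\langle(za,zb)\rangle_q: z\in\mathbb{F}_{q^t}^*\}$ of $\mathrm{PG}(2t-1,q)$. -}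

module Defs where

open import Level using (_⊔_)
open import Algebra.Bundles using (CommutativeRing)
open import Data.Nat as ℕ using (ℕ; zero; suc)
open import Data.Nat.Primality using (Prime)
open import Data.Fin using (Fin)
open import Data.Product using (_×_; _,_; ∃; ∃₂; proj₁; proj₂)
open import Relation.Nullary using (¬_)
open import Relation.Binary.PropositionalEquality as ≡ using (_≡_)
open import Function.Bundles using (Inverse; _⇔_)

IsPrimePower : ℕ → Set
IsPrimePower q = ∃₂ λ p e → Prime p × 1 ℕ.≤ e × q ≡ p ℕ.^ e

-- Σ_{i<t} q^i = (q^t - 1)/(q - 1)
geomSum : ℕ → ℕ → ℕ
geomSum q zero    = 0
geomSum q (suc t) = geomSum q t ℕ.+ q ℕ.^ t

module FieldTheory {c ℓ} (R : CommutativeRing c ℓ) where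
  open CommutativeRing R

  record IsField : Set (c ⊔ ℓ) where
    field
      nontrivial : ¬ (1# ≈ 0#)
      inverse    : ∀ x → ¬ (x ≈ 0#) → ∃ λ y → x * y ≈ 1#

  HasCardinality : ℕ → Set (c ⊔ ℓ)
  HasCardinality n = Inverse setoid (≡.setoid (Fin n))

  pow : Carrier → ℕ → Carrier
  pow x zero    = 1#
  pow x (suc n) = x * pow x n

  -- the subfield F_q of F_{q^t}: fixed points of x ↦ x^q
  InFq : ℕ → Carrier → Set ℓ
  InFq q x = pow x q ≈ x

  -- norm N(x) = x^((q^t-1)/(q-1)) of F_{q^t} over F_q
  N : ℕ → ℕ → Carrier → Carrier
  N q t x = pow x (geomSum q t)

  V : Set c
  V = Carrier × Carrier

  NonZero : V → Set ℓ
  NonZero (a , b) = ¬ (a ≈ 0# × b ≈ 0#)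

  -- ⟨v⟩_q = ⟨w⟩_q  (same point of PG(2t-1,q) = PG_q(F_{q^t}^2))
  SamePoint : ℕ → V → V → Set (c ⊔ ℓ)
  SamePoint q (a , b) (a' , b') =
    ∃ λ l → InFq q l × ¬ (l ≈ 0#) × (a ≈ l * a' × b ≈ l * b')

  -- a set of points of PG(2t-1,q), given by its membership predicate on
  -- (nonzero) representative vectors
  -- F(⟨(a,b)⟩_{q^t}) = {⟨(za,zb)⟩_q : z ∈ F_{q^t}^*}
  FieldRed : ℕ → V → V → Set (c ⊔ ℓ)
  FieldRed q (a , b) w = ∃ λ z → ¬ (z ≈ 0#) × SamePoint q w (z * a , z * b)

  S0 : ℕ → Carrier → V → Set (c ⊔ ℓ)
  S0 q k w = ∃ λ z → ¬ (z ≈ 0#) × SamePoint q w (z , k * z)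

  SamePointSet : (V → Set (c ⊔ ℓ)) → (V → Set (c ⊔ ℓ)) → Set (c ⊔ ℓ)
  SamePointSet P Q = ∀ w → NonZero w → P w ⇔ Q w

module Submission where

-- For μ ≠ 0 and k with μ^σ = kμ we have
-- (μ, μ^σ) = μ·(1, k), so F(⟨(μ, μ^σ)⟩) = S_{0,k} in any field (fieldRed-line).
-- The proposition thus reduces to: {k : μ^σ = kμ for some μ ≠ 0} = {k : N(k) = 1}.
--   ⊆  With g = 1 + q + … + q^(t-1), Fermat's little theorem puts μ^g in F_q,
--      so μ^g is fixed by σ and N(k)·μ^g = (μ^σ)^g = (μ^g)^σ = μ^g  (norm-of-ratio).
--   ⊇  (Hilbert 90) by counting.  Two solutions of μ^σ = kμ differ by a factor
--      fixed by σ, which lies in F_q because gcd(ν,t) = 1; so every k has at most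
--      q - 1 solutions, and at least (q^t - 1)/(q - 1) = g values of k occur.  They
--      all satisfy x^g = 1, which has at most g roots: no k with N(k) = 1 is left
--      over (hilbert90).

open import Defs
open import Algebra.Bundles using (CommutativeRing)
open import Data.Nat using (ℕ; _≤_; _^_)
open import Data.Nat.GCD using (gcd)
open import Data.Product using (_×_; _,_; ∃)
open import Relation.Nullary using (¬_)
open import Relation.Binary.PropositionalEquality using (_≡_; _≢_)

open import Data.Nat as ℕ using (zero; suc; z≤n; s≤s; _<_)
import Data.Nat.Properties as ℕP
open import Data.Nat.GCD using (GCD; gcd-GCD; module Bézout)
open import Data.Nat.Primality using (prime⇒nonTrivial)
open import Data.Fin as Fin using (Fin)
open import Data.Fin.Permutation using (permutation)
open import Data.Vec.Functional using (removeAt)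
import Data.Fin.Properties as FinP
open import Data.Product using (∃₂; proj₁; proj₂)
open import Data.Empty using (⊥-elim)
open import Data.List using (List; []; _∷_; length; filter; tabulate)
import Data.List.Properties as ListP
open import Data.List.Membership.Propositional using (_∈_; lose)
open import Data.List.Membership.Propositional.Properties using (∈-tabulate⁺; ∈-filter⁺; ∈-filter⁻)
open import Data.List.Relation.Unary.All as All using (All; []; _∷_)
import Data.List.Relation.Unary.All.Properties as AllP
open import Data.List.Relation.Unary.Any as Any using (Any; here; there; any?; satisfied)
import Data.List.Relation.Unary.Unique.Setoid as UniqueS
import Data.List.Relation.Unary.Unique.Setoid.Properties as Unique
open import Level using (_⊔_)
open import Relation.Binary.Bundles using (Setoid)
open import Relation.Nullary using (Dec; yes; no; ¬?; _×-dec_)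
import Relation.Nullary.Decidable as Dec
open import Relation.Unary using (Pred; Decidable)
open import Relation.Unary.Properties using (∁?)
import Relation.Binary.PropositionalEquality as ≡
open import Function.Bundles using (Inverse; mk⇔)

length-filter-split : ∀ {a p} {A : Set a} {P : Pred A p} (P? : Decidable P) xs →
  length xs ≡ length (filter P? xs) ℕ.+ length (filter (∁? P?) xs)
length-filter-split P? [] = ≡.refl
length-filter-split P? (x ∷ xs) with P? x
... | yes _ = ≡.cong suc (length-filter-split P? xs)
... | no _  = ≡.trans (≡.cong suc (length-filter-split P? xs)) (≡.sym (ℕP.+-suc _ _))

module Counting {a ℓ} (S : Setoid a ℓ) where
  open Setoid S renaming (Carrier to A)
  open UniqueS S using (Unique; []; _∷_)

  unique-constant-length : ∀ {z xs} → Unique xs → All (_≈ z) xs → length xs ≤ 1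
  unique-constant-length [] _ = z≤n
  unique-constant-length (_ ∷ []) _ = s≤s z≤n
  unique-constant-length ((x≉y ∷ _) ∷ _) (x≈z ∷ y≈z ∷ _) = ⊥-elim (x≉y (trans x≈z (sym y≈z)))

  fibre-count : ∀ {b p} {B : Set b} (R : A → B → Set p) (R? : ∀ d → Decidable (λ x → R x d))
    (r : ℕ) (ds : List B) → (∀ d {ys} → Unique ys → All (λ y → R y d) ys → length ys ≤ r) →
    ∀ {xs} → Unique xs → All (λ x → Any (R x) ds) xs → length xs ≤ r ℕ.* length ds
  fibre-count R R? r [] fibre {[]} _ _ = z≤n
  fibre-count R R? r [] fibre {_ ∷ _} _ (() ∷ _)
  fibre-count R R? r (d ∷ ds) fibre {xs} xs! cover = begin
      length xs
        ≡⟨ length-filter-split (R? d) xs ⟩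
      length (filter (R? d) xs) ℕ.+ length (filter (∁? (R? d)) xs)
        ≤⟨ ℕP.+-mono-≤ (fibre d (Unique.filter⁺ S (R? d) xs!) (AllP.all-filter (R? d) xs))
                       (fibre-count R R? r ds fibre (Unique.filter⁺ S (∁? (R? d)) xs!) rest) ⟩
      r ℕ.+ r ℕ.* length ds
        ≡⟨ ≡.sym (ℕP.*-suc r (length ds)) ⟩
      r ℕ.* suc (length ds) ∎
    where
      open ℕP.≤-Reasoning
      elsewhere : ∀ {x} → ¬ R x d × Any (R x) (d ∷ ds) → Any (R x) ds
      elsewhere (¬Rxd , here Rxd) = ⊥-elim (¬Rxd Rxd)
      elsewhere (_ , there covered) = covered
      rest : All (λ x → Any (R x) ds) (filter (∁? (R? d)) xs)
      rest = All.zipWith elsewhere (AllP.all-filter (∁? (R? d)) xs , AllP.filter⁺ (∁? (R? d)) cover)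

module FieldArithmetic {c ℓ} (F : CommutativeRing c ℓ) (isField : FieldTheory.IsField F) where
  open CommutativeRing F
  open FieldTheory F
  open IsField isField
  open import Relation.Binary.Reasoning.Setoid setoid
  open import Algebra.Solver.Ring.NaturalCoefficients.Default commutativeSemiring
  open import Algebra.Properties.Group +-group using (x∙y⁻¹≈ε⇒x≈y; //-rightDividesˡ; ⁻¹-involutive; ε⁻¹≈ε)
  import Algebra.Properties.CommutativeSemiring.Exp commutativeSemiring as Exp
  open UniqueS setoid using (Unique; _∷_)

  _⁻¹⟨_⟩ : ∀ x → x ≉ 0# → Carrier
  x ⁻¹⟨ x≉0 ⟩ = proj₁ (inverse x x≉0)

  *-inverseʳ : ∀ x (x≉0 : x ≉ 0#) → x * x ⁻¹⟨ x≉0 ⟩ ≈ 1#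
  *-inverseʳ x x≉0 = proj₂ (inverse x x≉0)

  *-inverseˡ : ∀ x (x≉0 : x ≉ 0#) → x ⁻¹⟨ x≉0 ⟩ * x ≈ 1#
  *-inverseˡ x x≉0 = trans (*-comm _ _) (*-inverseʳ x x≉0)

  *-cancelˡ : ∀ {a b d} → a ≉ 0# → a * b ≈ a * d → b ≈ d
  *-cancelˡ {a} {b} {d} a≉0 ab≈ad = begin
    b                    ≈⟨ sym (*-identityˡ b) ⟩
    1# * b               ≈⟨ *-congʳ (sym (*-inverseˡ a a≉0)) ⟩
    (a⁻¹ * a) * b        ≈⟨ *-assoc _ _ _ ⟩
    a⁻¹ * (a * b)        ≈⟨ *-congˡ ab≈ad ⟩
    a⁻¹ * (a * d)        ≈⟨ sym (*-assoc _ _ _) ⟩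
    (a⁻¹ * a) * d        ≈⟨ *-congʳ (*-inverseˡ a a≉0) ⟩
    1# * d               ≈⟨ *-identityˡ d ⟩
    d                    ∎
    where a⁻¹ = a ⁻¹⟨ a≉0 ⟩

  *-cancelʳ : ∀ {a b d} → a ≉ 0# → b * a ≈ d * a → b ≈ d
  *-cancelʳ a≉0 ba≈da = *-cancelˡ a≉0 (trans (*-comm _ _) (trans ba≈da (*-comm _ _)))

  zero-product : ∀ {a b} → a * b ≈ 0# → a ≉ 0# → b ≈ 0#
  zero-product {a} ab≈0 a≉0 = *-cancelˡ a≉0 (trans ab≈0 (sym (zeroʳ a)))

  *-nonzero : ∀ {a b} → a ≉ 0# → b ≉ 0# → a * b ≉ 0#
  *-nonzero a≉0 b≉0 ab≈0 = b≉0 (zero-product ab≈0 a≉0)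

  ⁻¹-nonzero : ∀ x (x≉0 : x ≉ 0#) → x ⁻¹⟨ x≉0 ⟩ ≉ 0#
  ⁻¹-nonzero x x≉0 x⁻¹≈0 = nontrivial (trans (sym (*-inverseʳ x x≉0)) (trans (*-congˡ x⁻¹≈0) (zeroʳ x)))

  pow≡^ : ∀ x m → pow x m ≡ x Exp.^ m
  pow≡^ x zero = ≡.refl
  pow≡^ x (suc m) = ≡.cong (x *_) (pow≡^ x m)

  pow-cong : ∀ {x y} m → x ≈ y → pow x m ≈ pow y m
  pow-cong {x} {y} m x≈y rewrite pow≡^ x m | pow≡^ y m = Exp.^-congˡ m x≈y

  pow-+ : ∀ x m k → pow x (m ℕ.+ k) ≈ pow x m * pow x k
  pow-+ x m k rewrite pow≡^ x (m ℕ.+ k) | pow≡^ x m | pow≡^ x k = Exp.^-homo-* x m k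

  pow-* : ∀ x m k → pow x (m ℕ.* k) ≈ pow (pow x m) k
  pow-* x m k rewrite pow≡^ x (m ℕ.* k) | pow≡^ (pow x m) k | pow≡^ x m = sym (Exp.^-assocʳ x m k)

  pow-distrib : ∀ x y m → pow (x * y) m ≈ pow x m * pow y m
  pow-distrib x y m rewrite pow≡^ (x * y) m | pow≡^ x m | pow≡^ y m = Exp.^-distrib-* x y m

  pow-one : ∀ m → pow 1# m ≈ 1#
  pow-one zero = refl
  pow-one (suc m) = trans (*-identityˡ _) (pow-one m)

  pow-nonzero : ∀ {x} m → x ≉ 0# → pow x m ≉ 0#
  pow-nonzero zero x≉0 = nontrivial
  pow-nonzero (suc m) x≉0 = *-nonzero x≉0 (pow-nonzero m x≉0)

  -- f is a polynomial function of degree < n, presented in Horner form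
  -- f(x) = u + x·g(x) with deg g < n - 1.
  DegreeBelow : ℕ → (Carrier → Carrier) → Set (c ⊔ ℓ)
  DegreeBelow zero f = ∀ x → f x ≈ 0#
  DegreeBelow (suc n) f =
    ∃₂ λ (u : Carrier) (g : Carrier → Carrier) → DegreeBelow n g × (∀ x → f x ≈ u + x * g x)

  degree-raise : ∀ n {f} → DegreeBelow n f → DegreeBelow (suc n) f
  degree-raise zero f≈0 = 0# , (λ _ → 0#) , (λ _ → refl) ,
    λ x → trans (f≈0 x) (sym (trans (+-identityˡ _) (zeroʳ x)))
  degree-raise (suc n) (u , g , deg-g , f≈) = u , g , degree-raise n deg-g , f≈

  degree-+ : ∀ n {f h} → DegreeBelow n f → DegreeBelow n h → DegreeBelow n (λ x → f x + h x)
  degree-+ zero f≈0 h≈0 x = trans (+-cong (f≈0 x) (h≈0 x)) (+-identityˡ 0#)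
  degree-+ (suc n) {f} {h} (u , g , deg-g , f≈) (u' , g' , deg-g' , h≈) =
    u + u' , (λ x → g x + g' x) , degree-+ n deg-g deg-g' , λ x → begin
      f x + h x                        ≈⟨ +-cong (f≈ x) (h≈ x) ⟩
      (u + x * g x) + (u' + x * g' x)  ≈⟨ solve 5 (λ u u' x gx gx' →
                                            (u :+ x :* gx) :+ (u' :+ x :* gx') := (u :+ u') :+ x :* (gx :+ gx'))
                                            refl u u' x (g x) (g' x) ⟩
      (u + u') + x * (g x + g' x)      ∎

  degree-scale : ∀ n a {f} → DegreeBelow n f → DegreeBelow n (λ x → a * f x)
  degree-scale zero a f≈0 x = trans (*-congˡ (f≈0 x)) (zeroʳ a)
  degree-scale (suc n) a {f} (u , g , deg-g , f≈) =
    a * u , (λ x → a * g x) , degree-scale n a deg-g , λ x → begin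
      a * f x              ≈⟨ *-congˡ (f≈ x) ⟩
      a * (u + x * g x)    ≈⟨ solve 4 (λ a u x gx → a :* (u :+ x :* gx) := a :* u :+ x :* (a :* gx))
                                refl a u x (g x) ⟩
      a * u + x * (a * g x) ∎

  factor-theorem : ∀ n {f} → DegreeBelow (suc n) f → ∀ a →
    ∃ λ h → DegreeBelow n h × (∀ x → f x ≈ f a + (x - a) * h x)
  factor-theorem zero {f} (u , g , g≈0 , f≈) a = (λ _ → 0#) , (λ _ → refl) , λ x → begin
    f x                  ≈⟨ f≈ x ⟩
    u + x * g x          ≈⟨ +-congˡ (trans (*-congˡ (g≈0 x)) (zeroʳ x)) ⟩
    u + 0#               ≈⟨ +-congˡ (sym (trans (*-congˡ (g≈0 a)) (zeroʳ a))) ⟩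
    u + a * g a          ≈⟨ sym (f≈ a) ⟩
    f a                  ≈⟨ sym (+-identityʳ _) ⟩
    f a + 0#             ≈⟨ +-congˡ (sym (zeroʳ _)) ⟩
    f a + (x - a) * 0#   ∎
  factor-theorem (suc n) {f} (u , g , deg-g , f≈) a =
    (λ x → g x + a * k x) ,
    degree-+ (suc n) deg-g (degree-scale (suc n) a (degree-raise n deg-k)) ,
    λ x → sym (begin
      f a + (x - a) * (g x + a * k x)
        ≈⟨ +-cong (f≈ a) (*-congˡ (+-congʳ (g≈ x))) ⟩
      (u + a * g a) + (x - a) * ((g a + (x - a) * k x) + a * k x)
        ≈⟨ solve 5 (λ u d a ga kx → (u :+ a :* ga) :+ d :* ((ga :+ d :* kx) :+ a :* kx)
                                       := u :+ (d :+ a) :* (ga :+ d :* kx))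
                   refl u (x - a) a (g a) (k x) ⟩
      u + ((x - a) + a) * (g a + (x - a) * k x)
        ≈⟨ +-congˡ (*-cong (//-rightDividesˡ a x) (sym (g≈ x))) ⟩
      u + x * g x
        ≈⟨ sym (f≈ x) ⟩
      f x ∎)
    where
      k = proj₁ (factor-theorem n deg-g a)
      deg-k = proj₁ (proj₂ (factor-theorem n deg-g a))
      g≈ = proj₂ (proj₂ (factor-theorem n deg-g a))

  vanishes : ∀ n {f} → DegreeBelow n f → ∀ {rs} → Unique rs → All (λ r → f r ≈ 0#) rs →
    n ≤ length rs → ∀ x → f x ≈ 0#
  vanishes zero f≈0 _ _ _ = f≈0
  vanishes (suc n) {f} deg {r ∷ rs} (r≉rs ∷ rs!) (fr≈0 ∷ roots) (s≤s n≤|rs|) x = begin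
    f x                  ≈⟨ f≈ x ⟩
    f r + (x - r) * h x  ≈⟨ +-cong fr≈0 (*-congˡ (h≈0 x)) ⟩
    0# + (x - r) * 0#    ≈⟨ +-identityˡ _ ⟩
    (x - r) * 0#         ≈⟨ zeroʳ _ ⟩
    0#                   ∎
    where
      h = proj₁ (factor-theorem n deg r)
      deg-h = proj₁ (proj₂ (factor-theorem n deg r))
      f≈ = proj₂ (proj₂ (factor-theorem n deg r))
      -- h vanishes at every other root r', since (r' - r)·h(r') = f(r') = 0
      h-root : ∀ {r'} → r ≉ r' × f r' ≈ 0# → h r' ≈ 0#
      h-root {r'} (r≉r' , fr'≈0) = zero-product
        (begin
          (r' - r) * h r'        ≈⟨ sym (+-identityˡ _) ⟩
          0# + (r' - r) * h r'   ≈⟨ +-congʳ (sym fr≈0) ⟩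
          f r + (r' - r) * h r'  ≈⟨ sym (f≈ r') ⟩
          f r'                   ≈⟨ fr'≈0 ⟩
          0#                     ∎)
        (λ r'-r≈0 → r≉r' (sym (x∙y⁻¹≈ε⇒x≈y r' r r'-r≈0)))
      h≈0 = vanishes n deg-h rs! (All.zipWith h-root (r≉rs , roots)) n≤|rs|

  monomial : ∀ d → DegreeBelow (suc d) (λ x → pow x d)
  monomial zero = 1# , (λ _ → 0#) , (λ _ → refl) ,
    λ x → sym (trans (+-congˡ (zeroʳ x)) (+-identityʳ 1#))
  monomial (suc d) = 0# , (λ x → pow x d) , monomial d , λ x → sym (+-identityˡ _)

  roots-of-unity-bound : ∀ d → 1 ≤ d → ∀ {ys} → Unique ys → All (λ y → pow y d ≈ 1#) ys →
    length ys ≤ d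
  roots-of-unity-bound (suc d) _ {ys} ys! roots = ℕP.≮⇒≥ (λ d<|ys| → nontrivial (1≈0 d<|ys|))
    where
      unity : DegreeBelow (suc (suc d)) (λ x → pow x (suc d) - 1#)
      unity = - 1# , (λ x → pow x d) , monomial d , λ x → +-comm _ _
      1≈0 : suc d < length ys → 1# ≈ 0#
      1≈0 d<|ys| = begin
        1#            ≈⟨ sym (⁻¹-involutive 1#) ⟩
        - (- 1#)      ≈⟨ -‿cong (begin
                           - 1#                    ≈⟨ sym (+-identityˡ _) ⟩
                           0# + - 1#               ≈⟨ +-congʳ (sym (zeroˡ _)) ⟩
                           0# * pow 0# d - 1#      ≈⟨ vanishes _ unity ys!
                                                        (All.map (λ y^d≈1 → trans (+-congʳ y^d≈1) (-‿inverseʳ 1#)) roots)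
                                                        d<|ys| 0# ⟩
                           0#                      ∎) ⟩
        - 0#          ≈⟨ ε⁻¹≈ε ⟩
        0#            ∎

  -- F(⟨(μ, kμ)⟩_{q^t}) = S_{0,k}: the vectors z·(μ, kμ) and z'·(1, k) (z, z' ≠ 0)
  -- are the same, via z' = zμ.
  fieldRed-line : ∀ q k {μ b} → μ ≉ 0# → b ≈ k * μ → SamePointSet (FieldRed q (μ , b)) (S0 q k)
  fieldRed-line q k {μ} {b} μ≉0 b≈kμ w _ = mk⇔ to-S0 from-S0
    where
      μ⁻¹ = μ ⁻¹⟨ μ≉0 ⟩
      same-point : ∀ {a b a' b'} → SamePoint q w (a , b) → a ≈ a' → b ≈ b' → SamePoint q w (a' , b')
      same-point (l , l∈Fq , l≉0 , w₁≈ , w₂≈) a≈a' b≈b' =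
        l , l∈Fq , l≉0 , trans w₁≈ (*-congˡ a≈a') , trans w₂≈ (*-congˡ b≈b')
      to-S0 : FieldRed q (μ , b) w → S0 q k w
      to-S0 (z , z≉0 , w≡z·v) = z * μ , *-nonzero z≉0 μ≉0 , same-point w≡z·v refl (begin
        z * b          ≈⟨ *-congˡ b≈kμ ⟩
        z * (k * μ)    ≈⟨ solve 3 (λ z k μ → z :* (k :* μ) := k :* (z :* μ)) refl z k μ ⟩
        k * (z * μ)    ∎)
      from-S0 : S0 q k w → FieldRed q (μ , b) w
      from-S0 (z , z≉0 , w≡z·v) = z * μ⁻¹ , *-nonzero z≉0 (⁻¹-nonzero μ μ≉0) ,
        same-point w≡z·v
          (sym (begin
            (z * μ⁻¹) * μ   ≈⟨ *-assoc _ _ _ ⟩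
            z * (μ⁻¹ * μ)   ≈⟨ *-congˡ (*-inverseˡ μ μ≉0) ⟩
            z * 1#          ≈⟨ *-identityʳ z ⟩
            z               ∎))
          (sym (begin
            (z * μ⁻¹) * b         ≈⟨ *-congˡ b≈kμ ⟩
            (z * μ⁻¹) * (k * μ)   ≈⟨ solve 4 (λ z i k μ → (z :* i) :* (k :* μ) := (k :* z) :* (i :* μ))
                                       refl z μ⁻¹ k μ ⟩
            (k * z) * (μ⁻¹ * μ)   ≈⟨ *-congˡ (*-inverseˡ μ μ≉0) ⟩
            (k * z) * 1#          ≈⟨ *-identityʳ _ ⟩
            k * z                 ∎))

module FiniteField {c ℓ} (F : CommutativeRing c ℓ) (isField : FieldTheory.IsField F)
                   (n : ℕ) (card : FieldTheory.HasCardinality F n) where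
  open CommutativeRing F
  open FieldTheory F
  open IsField isField
  open FieldArithmetic F isField
  open Inverse card using (to; from; to-cong; inverseˡ; inverseʳ)
  open import Relation.Binary.Reasoning.Setoid setoid
  -- Product.sum f is the product of all f i
  import Algebra.Properties.CommutativeMonoid.Sum *-commutativeMonoid as Product
  open UniqueS setoid using (Unique)

  from-to : ∀ x → from (to x) ≈ x
  from-to x = inverseʳ ≡.refl

  to-from : ∀ i → to (from i) ≡ i
  to-from i = inverseˡ refl

  to-injective : ∀ {x y} → to x ≡ to y → x ≈ y
  to-injective {x} {y} to≡ = trans (sym (from-to x)) (trans (reflexive (≡.cong from to≡)) (from-to y))

  from-injective : ∀ {i j} → from i ≈ from j → i ≡ j
  from-injective {i} {j} from≈ = ≡.trans (≡.sym (to-from i)) (≡.trans (to-cong from≈) (to-from j))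

  infix 4 _≟_
  _≟_ : ∀ x y → Dec (x ≈ y)
  x ≟ y = Dec.map′ to-injective to-cong (to x Fin.≟ to y)

  elements : List Carrier
  elements = tabulate from

  elements-unique : Unique elements
  elements-unique = Unique.tabulate⁺ setoid from-injective

  representative∈elements : ∀ x → from (to x) ∈ elements
  representative∈elements x = ∈-tabulate⁺ (to x)

  units : List Carrier
  units = filter (∁? (_≟ 0#)) elements

  units-unique : Unique units
  units-unique = Unique.filter⁺ setoid (∁? (_≟ 0#)) elements-unique

  units-nonzero : All (_≉ 0#) units
  units-nonzero = AllP.all-filter (∁? (_≟ 0#)) elements

  units-count : n ≤ suc (length units)
  units-count = ℕP.≤-trans
    (ℕP.≤-reflexive (≡.trans (≡.sym (ListP.length-tabulate from)) (length-filter-split (_≟ 0#) elements)))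
    (ℕP.+-monoˡ-≤ (length units) at-most-one-zero)
    where
      zeros = filter (_≟ 0#) elements
      at-most-one-zero : length zeros ≤ 1
      at-most-one-zero = Counting.unique-constant-length setoid
        (Unique.filter⁺ setoid (_≟ 0#) elements-unique) (AllP.all-filter (_≟ 0#) elements)

  -- Fermat's little theorem.  For x ≠ 0, y ↦ xy permutes the field; comparing the
  -- products of all elements (with 0 replaced by 1) before and after gives x^n = x.
  private
    if-zero : Carrier → Carrier → Carrier → Carrier
    if-zero y a b with y ≟ 0#
    ... | yes _ = a
    ... | no _ = b

    if-zero-yes : ∀ {y a b} → y ≈ 0# → if-zero y a b ≈ a
    if-zero-yes {y} y≈0 with y ≟ 0#
    ... | yes _ = refl
    ... | no y≉0 = ⊥-elim (y≉0 y≈0)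

    if-zero-no : ∀ {y a b} → y ≉ 0# → if-zero y a b ≈ b
    if-zero-no {y} y≉0 with y ≟ 0#
    ... | yes y≈0 = ⊥-elim (y≉0 y≈0)
    ... | no _ = refl

    unzero : Carrier → Carrier
    unzero y = if-zero y 1# y

    unzero-cong : ∀ {y y'} → y ≈ y' → unzero y ≈ unzero y'
    unzero-cong {y} {y'} y≈y' with y ≟ 0#
    ... | yes y≈0 = sym (if-zero-yes (trans (sym y≈y') y≈0))
    ... | no y≉0 = trans y≈y' (sym (if-zero-no (λ y'≈0 → y≉0 (trans y≈y' y'≈0))))

    unzero-nonzero : ∀ y → unzero y ≉ 0#
    unzero-nonzero y with y ≟ 0#
    ... | yes _ = nontrivial
    ... | no y≉0 = y≉0

    unzero-scale : ∀ {x} y → x ≉ 0# → unzero (x * y) * if-zero y x 1# ≈ x * unzero y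
    unzero-scale {x} y x≉0 with y ≟ 0#
    ... | yes y≈0 = begin
      unzero (x * y) * x   ≈⟨ *-congʳ (if-zero-yes (trans (*-congˡ y≈0) (zeroʳ x))) ⟩
      1# * x               ≈⟨ *-comm _ _ ⟩
      x * 1#               ∎
    ... | no y≉0 = begin
      unzero (x * y) * 1#  ≈⟨ *-identityʳ _ ⟩
      unzero (x * y)       ≈⟨ if-zero-no (*-nonzero x≉0 y≉0) ⟩
      x * y                ∎

    product-nonzero : ∀ {m} (f : Fin m → Carrier) → (∀ i → f i ≉ 0#) → Product.sum f ≉ 0#
    product-nonzero {zero} f _ = nontrivial
    product-nonzero {suc m} f f≉0 =
      *-nonzero (f≉0 Fin.zero) (product-nonzero (λ i → f (Fin.suc i)) (λ i → f≉0 (Fin.suc i)))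

    product-single : ∀ {m} (f : Fin m → Carrier) i → (∀ j → j ≢ i → f j ≈ 1#) → Product.sum f ≈ f i
    product-single {suc m} f i others = begin
      Product.sum f                         ≈⟨ Product.sum-remove f ⟩
      f i * Product.sum (removeAt f i)      ≈⟨ *-congˡ (Product.sum-cong-≋ {m} {removeAt f i} {λ _ → 1#}
                                                  (λ j → others _ (FinP.punchInᵢ≢i i j))) ⟩
      f i * Product.sum {m} (λ _ → 1#)      ≈⟨ *-congˡ (Product.sum-replicate-zero m) ⟩
      f i * 1#                              ≈⟨ *-identityʳ _ ⟩
      f i                                   ∎

    product-constant : ∀ m x → Product.sum {m} (λ _ → x) ≈ pow x m
    product-constant zero x = refl
    product-constant (suc m) x = *-congˡ (product-constant m x)

  fermat : ∀ x → pow x n ≈ x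
  fermat x with x ≟ 0#
  ... | yes x≈0 = trans (pow-cong n x≈0) (trans (pow-zero n (to x)) (sym x≈0))
    where
      pow-zero : ∀ m → Fin m → pow 0# m ≈ 0#
      pow-zero (suc m) _ = zeroˡ _
  ... | no x≉0 = sym (*-cancelˡ P≉0 (begin
      P * x                               ≈⟨ *-congˡ (sym corrections) ⟩
      P * Product.sum C                   ≈⟨ *-congʳ (Product.sum-permute U π) ⟩
      Product.sum (λ i → U (π⁺ i)) * Product.sum C
                                          ≈⟨ *-congʳ (Product.sum-cong-≋ {n} {λ i → U (π⁺ i)} {Ux}
                                                        (λ i → unzero-cong (from-to _))) ⟩
      Product.sum Ux * Product.sum C      ≈⟨ sym (Product.∑-distrib-+ Ux C) ⟩
      Product.sum (λ i → Ux i * C i)      ≈⟨ Product.sum-cong-≋ {n} {λ i → Ux i * C i} {λ i → x * U i}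
                                                (λ i → unzero-scale (from i) x≉0) ⟩
      Product.sum (λ i → x * U i)         ≈⟨ Product.∑-distrib-+ (λ _ → x) U ⟩
      Product.sum {n} (λ _ → x) * P       ≈⟨ *-congʳ (product-constant n x) ⟩
      pow x n * P                         ≈⟨ *-comm _ _ ⟩
      P * pow x n                         ∎))
    where
      x⁻¹ = x ⁻¹⟨ x≉0 ⟩
      π⁺ π⁻ : Fin n → Fin n
      π⁺ i = to (x * from i)
      π⁻ i = to (x⁻¹ * from i)
      rescale : ∀ a b → b * a ≈ 1# → ∀ i → to (a * from (to (b * from i))) ≡ i
      rescale a b ba≈1 i = ≡.trans (to-cong (begin
        a * from (to (b * from i))   ≈⟨ *-congˡ (from-to _) ⟩
        a * (b * from i)             ≈⟨ sym (*-assoc _ _ _) ⟩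
        (a * b) * from i             ≈⟨ *-congʳ (trans (*-comm a b) ba≈1) ⟩
        1# * from i                  ≈⟨ *-identityˡ _ ⟩
        from i                       ∎)) (to-from i)
      π = permutation π⁺ π⁻ (rescale x x⁻¹ (*-inverseˡ x x≉0)) (rescale x⁻¹ x (*-inverseʳ x x≉0))
      U Ux C : Fin n → Carrier
      U i = unzero (from i)
      Ux i = unzero (x * from i)
      C i = if-zero (from i) x 1#
      P = Product.sum U
      P≉0 = product-nonzero U (λ i → unzero-nonzero (from i))
      corrections : Product.sum C ≈ x
      corrections = trans (product-single C (to 0#) (λ i i≢0 → if-zero-no (λ from-i≈0 →
                               i≢0 (≡.trans (≡.sym (to-from i)) (to-cong from-i≈0)))))
                          (if-zero-yes (from-to 0#))

-- (q - 1)(1 + q + … + q^(t-1)) + 1 = q^t, written for q = m + 1.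
geomSum-count : ∀ m t → suc (geomSum (suc m) t ℕ.* m) ≡ suc m ^ t
geomSum-count m zero = ≡.refl
geomSum-count m (suc t) = begin
  suc ((G ℕ.+ P) ℕ.* m)        ≡⟨ ≡.cong suc (ℕP.*-distribʳ-+ m G P) ⟩
  suc (G ℕ.* m ℕ.+ P ℕ.* m)    ≡⟨ ≡.cong (ℕ._+ P ℕ.* m) (geomSum-count m t) ⟩
  P ℕ.+ P ℕ.* m                ≡⟨ ≡.cong (P ℕ.+_) (ℕP.*-comm P m) ⟩
  suc m ℕ.* P                  ∎
  where
    open ≡.≡-Reasoning
    G = geomSum (suc m) t
    P = suc m ^ t

prime-power≥2 : ∀ {q} → IsPrimePower q → 2 ≤ q
prime-power≥2 (p , e , p-prime , 1≤e , q≡p^e) = ≡.subst (2 ≤_) (≡.sym q≡p^e) (begin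
  2        ≤⟨ p>1 ⟩
  p        ≡⟨ ≡.sym (ℕP.^-identityʳ p) ⟩
  p ^ 1    ≤⟨ ℕP.^-monoʳ-≤ p {{ℕ.>-nonZero (ℕP.<⇒≤ p>1)}} 1≤e ⟩
  p ^ e    ∎)
  where
    open ℕP.≤-Reasoning
    p>1 = ℕ.nonTrivial⇒n>1 p {{prime⇒nonTrivial p-prime}}

module ExtensionField {c ℓ} (F : CommutativeRing c ℓ) (isField : FieldTheory.IsField F)
                      (q₁ t₁ : ℕ) (q₁≥1 : 1 ≤ q₁)
                      (card : FieldTheory.HasCardinality F (suc q₁ ^ suc t₁)) where
  q t : ℕ
  q = suc q₁
  t = suc t₁

  open CommutativeRing F
  open FieldTheory F
  open FieldArithmetic F isField
  open FiniteField F isField (q ^ t) card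
  open Inverse card using (to; from)
  open import Relation.Binary.Reasoning.Setoid setoid
  open import Algebra.Solver.Ring.NaturalCoefficients.Default commutativeSemiring
  open UniqueS setoid using (Unique; _∷_)
  open Bézout.Identity using (+-; -+)

  frob : ℕ → Carrier → Carrier
  frob e x = pow x (q ^ e)

  frob-1 : ∀ x → frob 1 x ≈ pow x q
  frob-1 x = reflexive (≡.cong (pow x) (ℕP.*-identityʳ q))

  frob-+ : ∀ a b x → frob (a ℕ.+ b) x ≈ frob b (frob a x)
  frob-+ a b x = trans (reflexive (≡.cong (pow x) (ℕP.^-distribˡ-+-* q a b))) (pow-* x (q ^ a) (q ^ b))

  frob-iterate : ∀ e m {x} → frob e x ≈ x → frob (m ℕ.* e) x ≈ x
  frob-iterate e zero {x} _ = *-identityʳ x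
  frob-iterate e (suc m) {x} fixed =
    trans (frob-+ e (m ℕ.* e) x) (trans (pow-cong (q ^ (m ℕ.* e)) fixed) (frob-iterate e m fixed))

  Fq-fixed : ∀ e {x} → pow x q ≈ x → frob e x ≈ x
  Fq-fixed e {x} x∈Fq = trans (reflexive (≡.cong (λ m → frob m x) (≡.sym (ℕP.*-identityʳ e))))
                              (frob-iterate 1 e (trans (frob-1 x) x∈Fq))

  frob-period : ∀ m x → frob (m ℕ.* t) x ≈ x
  frob-period m x = frob-iterate t m (fermat x)

  -- each frob e is injective, being inverted by frob (e·t₁)
  frob-injective : ∀ e {x y} → frob e x ≈ frob e y → x ≈ y
  frob-injective e {x} {y} fx≈fy = begin
    x                               ≈⟨ sym (undo x) ⟩
    frob (e ℕ.+ e ℕ.* t₁) x         ≈⟨ frob-+ e (e ℕ.* t₁) x ⟩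
    frob (e ℕ.* t₁) (frob e x)      ≈⟨ pow-cong (q ^ (e ℕ.* t₁)) fx≈fy ⟩
    frob (e ℕ.* t₁) (frob e y)      ≈⟨ sym (frob-+ e (e ℕ.* t₁) y) ⟩
    frob (e ℕ.+ e ℕ.* t₁) y         ≈⟨ undo y ⟩
    y                               ∎
    where
      undo : ∀ z → frob (e ℕ.+ e ℕ.* t₁) z ≈ z
      undo z = trans (reflexive (≡.cong (λ m → frob m z) (≡.sym (ℕP.*-suc e t₁)))) (frob-period e z)

  frob-fixed-difference : ∀ e e' {y} → frob e y ≈ y → frob (e' ℕ.+ e) y ≈ y → frob e' y ≈ y
  frob-fixed-difference e e' {y} fixed fixed' = frob-injective e (begin
    frob e (frob e' y)   ≈⟨ sym (frob-+ e' e y) ⟩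
    frob (e' ℕ.+ e) y    ≈⟨ fixed' ⟩
    y                    ≈⟨ sym fixed ⟩
    frob e y             ∎)

  -- for gcd(e,t) = 1 the fixed field of frob e is F_q: write 1 = ae - bt or bt - ae
  frob-fixed-coprime : ∀ e {y} → gcd e t ≡ 1 → frob e y ≈ y → pow y q ≈ y
  frob-fixed-coprime e {y} coprime fixed = trans (sym (frob-1 y)) frob-fixed-1
    where
      frob-fixed-1 : frob 1 y ≈ y
      frob-fixed-1 with Bézout.identity (≡.subst (GCD e t) coprime (gcd-GCD e t))
      ... | +- a b 1+bt≡ae = frob-fixed-difference (b ℕ.* t) 1 (frob-period b y)
              (trans (reflexive (≡.cong (λ m → frob m y) 1+bt≡ae)) (frob-iterate e a fixed))
      ... | -+ a b 1+ae≡bt = frob-fixed-difference (a ℕ.* e) 1 (frob-iterate e a fixed)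
              (trans (reflexive (≡.cong (λ m → frob m y) 1+ae≡bt)) (frob-period b y))

  g : ℕ
  g = geomSum q t

  g≥1 : 1 ≤ g
  g≥1 = ℕP.≤-trans (ℕP.m^n>0 q t₁) (ℕP.m≤n+m (q ^ t₁) (geomSum q t₁))

  -- N(μ) = μ^g lies in F_q, because μ^(gq) · μ = μ^(g + q^t) = μ^g · μ
  norm-in-Fq : ∀ {μ} → μ ≉ 0# → pow (N q t μ) q ≈ N q t μ
  norm-in-Fq {μ} μ≉0 = *-cancelʳ μ≉0 (begin
    pow (pow μ g) q * μ         ≈⟨ *-congʳ (sym (pow-* μ g q)) ⟩
    pow μ (g ℕ.* q) * μ         ≈⟨ *-comm _ _ ⟩
    pow μ (suc (g ℕ.* q))       ≡⟨ ≡.cong (pow μ) exponent ⟩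
    pow μ (g ℕ.+ q ^ t)         ≈⟨ pow-+ μ g (q ^ t) ⟩
    pow μ g * pow μ (q ^ t)     ≈⟨ *-congˡ (fermat μ) ⟩
    pow μ g * μ                 ∎)
    where
      exponent : suc (g ℕ.* q) ≡ g ℕ.+ q ^ t
      exponent = ≡.trans (≡.cong suc (ℕP.*-suc g q₁))
                   (≡.trans (≡.sym (ℕP.+-suc g (g ℕ.* q₁))) (≡.cong (g ℕ.+_) (geomSum-count q₁ t)))

  FrobRatio : ℕ → Carrier → Carrier → Set ℓ
  FrobRatio e μ k = μ ≉ 0# × frob e μ ≈ k * μ

  frobRatio? : ∀ e μ k → Dec (FrobRatio e μ k)
  frobRatio? e μ k = ¬? (μ ≟ 0#) ×-dec (frob e μ ≟ k * μ)

  ratio-of : ∀ e {μ} → μ ≉ 0# → FrobRatio e μ (pow μ (ℕ.pred (q ^ e)))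
  ratio-of e {μ} μ≉0 = μ≉0 , (begin
    pow μ (q ^ e)                       ≡⟨ ≡.cong (pow μ) (≡.sym (ℕP.suc-pred (q ^ e) {{ℕP.m^n≢0 q e}})) ⟩
    μ * pow μ (ℕ.pred (q ^ e))          ≈⟨ *-comm _ _ ⟩
    pow μ (ℕ.pred (q ^ e)) * μ          ∎)

  -- ⊆: every ratio has norm 1, since N(k)·N(μ) = N(μ^σ) = N(μ)^σ = N(μ)
  norm-of-ratio : ∀ e {μ k} → FrobRatio e μ k → N q t k ≈ 1#
  norm-of-ratio e {μ} {k} (μ≉0 , σμ≈kμ) = *-cancelʳ (pow-nonzero g μ≉0) (begin
    pow k g * pow μ g         ≈⟨ sym (pow-distrib k μ g) ⟩
    pow (k * μ) g             ≈⟨ pow-cong g (sym σμ≈kμ) ⟩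
    pow (frob e μ) g          ≈⟨ sym (pow-* μ (q ^ e) g) ⟩
    pow μ (q ^ e ℕ.* g)       ≡⟨ ≡.cong (pow μ) (ℕP.*-comm (q ^ e) g) ⟩
    pow μ (g ℕ.* q ^ e)       ≈⟨ pow-* μ g (q ^ e) ⟩
    frob e (pow μ g)          ≈⟨ Fq-fixed e (norm-in-Fq μ≉0) ⟩
    pow μ g                   ≈⟨ sym (*-identityˡ _) ⟩
    1# * pow μ g              ∎)

  ratio-quotient-fixed : ∀ e {μ₀ μ k} (r₀ : FrobRatio e μ₀ k) → FrobRatio e μ k →
    frob e (μ * μ₀ ⁻¹⟨ proj₁ r₀ ⟩) ≈ μ * μ₀ ⁻¹⟨ proj₁ r₀ ⟩
  ratio-quotient-fixed e {μ₀} {μ} {k} (μ₀≉0 , σμ₀≈kμ₀) (_ , σμ≈kμ) = begin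
    frob e (μ * w)           ≈⟨ pow-distrib μ w (q ^ e) ⟩
    frob e μ * frob e w      ≈⟨ *-congʳ σμ≈kμ ⟩
    (k * μ) * frob e w       ≈⟨ solve 3 (λ k μ σw → (k :* μ) :* σw := μ :* (k :* σw)) refl k μ (frob e w) ⟩
    μ * (k * frob e w)       ≈⟨ *-congˡ k·σw≈w ⟩
    μ * w                    ∎
    where
      w = μ₀ ⁻¹⟨ μ₀≉0 ⟩
      k·σw≈w : k * frob e w ≈ w
      k·σw≈w = *-cancelˡ μ₀≉0 (begin
        μ₀ * (k * frob e w)     ≈⟨ solve 3 (λ μ₀ k σw → μ₀ :* (k :* σw) := (k :* μ₀) :* σw) refl μ₀ k (frob e w) ⟩
        (k * μ₀) * frob e w     ≈⟨ *-congʳ (sym σμ₀≈kμ₀) ⟩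
        frob e μ₀ * frob e w    ≈⟨ sym (pow-distrib μ₀ w (q ^ e)) ⟩
        frob e (μ₀ * w)         ≈⟨ pow-cong (q ^ e) (*-inverseʳ μ₀ μ₀≉0) ⟩
        frob e 1#               ≈⟨ pow-one (q ^ e) ⟩
        1#                      ≈⟨ sym (*-inverseʳ μ₀ μ₀≉0) ⟩
        μ₀ * w                  ∎)

  Fq-unit-root : ∀ {y} → y ≉ 0# → pow y q ≈ y → pow y q₁ ≈ 1#
  Fq-unit-root {y} y≉0 y∈Fq = *-cancelˡ y≉0 (trans y∈Fq (sym (*-identityʳ y)))

  -- for gcd(e,t) = 1 each k is the ratio of at most q - 1 distinct units:
  -- dividing them by one of them gives distinct (q-1)-th roots of unity
  fibre-bound : ∀ e → gcd e t ≡ 1 → ∀ k {ys} → Unique ys → All (λ μ → FrobRatio e μ k) ys →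
    length ys ≤ q₁
  fibre-bound e coprime k {[]} _ _ = z≤n
  fibre-bound e coprime k {μ₀ ∷ ys} ys! ratios@(r₀ ∷ _) =
    ≡.subst (_≤ q₁) (ListP.length-map divide (μ₀ ∷ ys))
      (roots-of-unity-bound q₁ q₁≥1 (Unique.map⁺ setoid setoid divide-injective ys!)
        (AllP.map⁺ (All.map root ratios)))
    where
      w≉0 = ⁻¹-nonzero μ₀ (proj₁ r₀)
      divide : Carrier → Carrier
      divide μ = μ * μ₀ ⁻¹⟨ proj₁ r₀ ⟩
      divide-injective : ∀ {a b} → divide a ≈ divide b → a ≈ b
      divide-injective = *-cancelʳ w≉0
      root : ∀ {μ} → FrobRatio e μ k → pow (divide μ) q₁ ≈ 1#
      root r = Fq-unit-root (*-nonzero (proj₁ r) w≉0)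
                 (frob-fixed-coprime e coprime (ratio-quotient-fixed e r₀ r))

  Occurs : ℕ → Carrier → Set (c ⊔ ℓ)
  Occurs e k = Any (λ μ → FrobRatio e μ k) units

  occurs? : ∀ e k → Dec (Occurs e k)
  occurs? e k = any? (λ μ → frobRatio? e μ k) units

  ratios : ℕ → List Carrier
  ratios e = filter (occurs? e) elements

  ratios-norm-one : ∀ e → All (λ k → N q t k ≈ 1#) (ratios e)
  ratios-norm-one e = All.tabulate λ k∈ratios →
    norm-of-ratio e (proj₂ (satisfied (proj₂ (∈-filter⁻ (occurs? e) {xs = elements} k∈ratios))))

  units-many : g ℕ.* q₁ ≤ length units
  units-many = ℕP.≤-pred (≡.subst (_≤ suc (length units)) (≡.sym (geomSum-count q₁ t)) units-count)

  -- there are at least g ratios, as each accounts for at most q - 1 units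
  ratios-count : ∀ e → gcd e t ≡ 1 → g ≤ length (ratios e)
  ratios-count e coprime = ℕP.*-cancelˡ-≤ q₁ {{ℕ.>-nonZero q₁≥1}}
    (ℕP.≤-trans (ℕP.≤-reflexive (ℕP.*-comm q₁ g)) (ℕP.≤-trans units-many
      (Counting.fibre-count setoid (FrobRatio e) (λ k μ → frobRatio? e μ k) q₁ (ratios e)
         (fibre-bound e coprime) units-unique (All.tabulate covered))))
    where
      covered : ∀ {μ} → μ ∈ units → Any (FrobRatio e μ) (ratios e)
      covered {μ} μ∈units = lose k∈ratios r
        where
          μ≉0 = All.lookup units-nonzero μ∈units
          k = pow μ (ℕ.pred (q ^ e))
          r : FrobRatio e μ (from (to k))
          r = μ≉0 , trans (proj₂ (ratio-of e μ≉0)) (*-congʳ (sym (from-to k)))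
          k∈ratios = ∈-filter⁺ (occurs? e) (representative∈elements k) (lose μ∈units r)

  -- ⊇ (Hilbert's Theorem 90): if N(k) = 1 then k is a ratio, for otherwise k and the
  -- at least g ratios would be more than g distinct roots of x^g = 1
  hilbert90 : ∀ e → gcd e t ≡ 1 → ∀ k → N q t k ≈ 1# → ∃ λ μ → FrobRatio e μ k
  hilbert90 e coprime k Nk≈1 with occurs? e k
  ... | yes occurs = satisfied occurs
  ... | no ¬occurs = ⊥-elim (ℕP.<⇒≱
        (roots-of-unity-bound g g≥1 (k∉ratios ∷ Unique.filter⁺ setoid (occurs? e) elements-unique)
                                    (Nk≈1 ∷ ratios-norm-one e))
        (ratios-count e coprime))
    where
      k∉ratios : All (k ≉_) (ratios e)
      k∉ratios = All.tabulate λ d∈ratios k≈d → ¬occurs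
        (Any.map (λ (μ≉0 , σμ≈dμ) → μ≉0 , trans σμ≈dμ (*-congʳ (sym k≈d)))
                 (proj₂ (∈-filter⁻ (occurs? e) {xs = elements} d∈ratios)))

proposition4p3 : ∀ {c ℓ} (F : CommutativeRing c ℓ) → FieldTheory.IsField F →
    (q t ν : ℕ) → IsPrimePower q → 3 ≤ t → FieldTheory.HasCardinality F (q ^ t) →
    gcd ν t ≡ 1 →
    let open CommutativeRing F
        open FieldTheory F
        σ : Carrier → Carrier
        σ x = pow x (q ^ ν)
    in
    -- every F(X), X ∈ 𝕃, is some S_{0,k} with N(k) = 1
    ((μ : Carrier) → ¬ (μ ≈ 0#) →
      ∃ λ k → (N q t k ≈ 1#) × SamePointSet (FieldRed q (μ , σ μ)) (S0 q k))
    ×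
    -- every S_{0,k} with N(k) = 1 is F(X) for some X ∈ 𝕃
    ((k : Carrier) → N q t k ≈ 1# →
      ∃ λ μ → (¬ (μ ≈ 0#)) × SamePointSet (FieldRed q (μ , σ μ)) (S0 q k))
proposition4p3 F isField q t ν q-prime-power t≥3 card coprime with prime-power≥2 q-prime-power
proposition4p3 F isField (suc (suc q₂)) (suc t₁) ν _ (s≤s _) card coprime | s≤s (s≤s z≤n) =
  (λ μ μ≉0 → let r = ratio-of ν μ≉0 in _ , norm-of-ratio ν r , fieldRed-line q _ μ≉0 (proj₂ r)) ,
  (λ k Nk≈1 → let (μ , r) = hilbert90 ν coprime k Nk≈1 in μ , proj₁ r , fieldRed-line q k (proj₁ r) (proj₂ r))
  where
    open ExtensionField F isField (suc q₂) t₁ (s≤s z≤n) card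
    open FieldArithmetic F isField using (fieldRed-line)
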